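{- Let $\alpha=\frac{1+\sqrt5}{2}$. If $x$ is an even positive integer, then \[v_2(\alpha^x-1)=\begin{cases} v_2(x)+1 & \text{if } x\equiv 0 \pmod 3,\\ 0 & \text{otherwise.}\end{cases}\]
   Context: $v_2$ denotes the $2$-adic valuation on $\mathbb{Q}(\sqrt5)$ (in which $2$ is inert), normalized by $v_2(2)=1$; on integers it is the usual $2$-adic valuation. -}

module Defs where

open import Data.Nat using (ℕ; zero; suc; _^_)
open import Data.Nat.Divisibility as ℕD using ()
open import Data.Integer as ℤ using (ℤ; +_; -[1+_])
open import Data.Product using (∃; _×_)
open import Relation.Nullary using (¬_)
open import Relation.Binary.PropositionalEquality using (_≡_)

-- The ring of integers ℤ[α] of ℚ(√5), α = (1+√5)/2, α² = α + 1.
-- An element  a + b·α  is represented by the pair (a , b) of integers.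
record ℤ[α] : Set where
  constructor _+_α
  field
    re : ℤ
    im : ℤ
open ℤ[α] public

infixl 6 _⊕_ _⊖_
infixl 7 _⊛_

_⊕_ : ℤ[α] → ℤ[α] → ℤ[α]
(a + b α) ⊕ (c + d α) = (a ℤ.+ c) + (b ℤ.+ d) α

_⊖_ : ℤ[α] → ℤ[α] → ℤ[α]
(a + b α) ⊖ (c + d α) = (a ℤ.- c) + (b ℤ.- d) α

-- (a + bα)(c + dα) = (ac + bd) + (ad + bc + bd)α   using α² = α + 1
_⊛_ : ℤ[α] → ℤ[α] → ℤ[α]
(a + b α) ⊛ (c + d α) =
  (a ℤ.* c ℤ.+ b ℤ.* d) + (a ℤ.* d ℤ.+ b ℤ.* c ℤ.+ b ℤ.* d) α

one : ℤ[α]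
one = (+ 1) + (+ 0) α

α : ℤ[α]
α = (+ 0) + (+ 1) α

ι : ℤ → ℤ[α]
ι n = n + (+ 0) α

_^α_ : ℤ[α] → ℕ → ℤ[α]
z ^α zero    = one
z ^α (suc n) = z ⊛ (z ^α n)

_∣α_ : ℤ[α] → ℤ[α] → Set
y ∣α z = ∃ λ w → y ⊛ w ≡ z

-- v₂(z) = k  in ℤ[α] (2 is inert, so v₂ restricted to the ring of
-- integers is the exponent of the largest power of 2 dividing z)
V₂α : ℤ[α] → ℕ → Set
V₂α z k = (ι (+ (2 ^ k)) ∣α z) × ¬ (ι (+ (2 ^ suc k)) ∣α z)

V₂ : ℕ → ℕ → Set
V₂ x k = (2 ^ k ℕD.∣ x) × ¬ (2 ^ suc k ℕD.∣ x)

-- α⁶ = 1 + 4(1 + 2α), so for odd c the power α⁶ᶜ is 1 + 4v with re v odd. Squaring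
-- 1 + 2ʲv (j ≥ 2, re v odd) gives 1 + 2ʲ⁺¹v′ with re v′ ≡ re v (mod 2); writing
-- x = 6c·2ᵏ⁻¹ with c odd therefore makes α^x − 1 exactly divisible by 2ᵏ⁺¹.
-- If 3 ∤ x, then α³ = 1 + 2α gives α^x ≡ α or α² = 1 + α (mod 2), so α^x − 1 has an
-- odd α-coordinate and is not divisible by 2.
module Submission where

open import Defs
open import Data.Nat as ℕ using (ℕ; zero; suc; _^_; _<_)
import Data.Nat.Properties as ℕₚ
open import Data.Nat.Divisibility
  using (_∣_; _∣?_; divides; ∣-refl; ∣m∣n⇒∣m+n; ∣m⇒∣m*n; *-monoˡ-∣)
open import Data.Nat.Primality using (Prime; prime?; euclidsLemma)
import Data.Nat.Tactic.RingSolver as ℕ-Solver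
open import Data.Integer using (ℤ; +_; _+_; _-_; _*_; ∣_∣)
import Data.Integer.Properties as ℤₚ
open import Data.Integer.Tactic.RingSolver using (solve-∀)
open import Data.Product using (∃; ∃₂; _×_; _,_)
open import Data.Sum using (_⊎_; inj₁; inj₂; [_,_])
open import Data.Empty using (⊥-elim)
open import Function using (_∘_; id)
open import Relation.Nullary using (¬_; contradiction)
open import Relation.Nullary.Decidable using (from-yes; from-no)
open import Relation.Binary.PropositionalEquality
  using (_≡_; _≢_; refl; sym; trans; cong; cong₂; subst; subst₂; module ≡-Reasoning)

V₂⇒odd-cofactor : ∀ {x} k → V₂ x k → ∃ λ o → ¬ 2 ∣ o × x ≡ o ℕ.* 2 ^ k
V₂⇒odd-cofactor k (divides o x≡o*2^k , 2^k+1∤x) =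
  o , 2∤o , x≡o*2^k
  where
  2∤o : ¬ 2 ∣ o
  2∤o 2∣o = 2^k+1∤x (subst (2 ^ suc k ∣_) (sym x≡o*2^k) (*-monoˡ-∣ (2 ^ k) 2∣o))

prime∣m*n^k⇒∣m : ∀ {p m n} k → Prime p → ¬ p ∣ n → p ∣ m ℕ.* n ^ k → p ∣ m
prime∣m*n^k⇒∣m {p} {m} zero    _  _   p∣m*1 = subst (p ∣_) (ℕₚ.*-identityʳ m) p∣m*1
prime∣m*n^k⇒∣m {p} {m} {n} (suc k) pp p∤n p∣m*n^k+1 =
  [ id , (λ p∣n → contradiction p∣n p∤n) ] (euclidsLemma m n pp
    (prime∣m*n^k⇒∣m k pp p∤n (subst (p ∣_) (sym (ℕₚ.*-assoc m n (n ^ k))) p∣m*n^k+1)))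

¬3∣⇒1+q*3⊎2+q*3 : ∀ n → ¬ 3 ∣ n → ∃ λ q → n ≡ 1 ℕ.+ q ℕ.* 3 ⊎ n ≡ 2 ℕ.+ q ℕ.* 3
¬3∣⇒1+q*3⊎2+q*3 0 3∤0 = ⊥-elim (3∤0 (divides 0 refl))
¬3∣⇒1+q*3⊎2+q*3 1 _   = 0 , inj₁ refl
¬3∣⇒1+q*3⊎2+q*3 2 _   = 0 , inj₂ refl
¬3∣⇒1+q*3⊎2+q*3 (suc (suc (suc n))) 3∤n+3
  with ¬3∣⇒1+q*3⊎2+q*3 n (3∤n+3 ∘ ∣m∣n⇒∣m+n ∣-refl)
... | q , inj₁ n≡ = suc q , inj₁ (cong (3 ℕ.+_) n≡)
... | q , inj₂ n≡ = suc q , inj₂ (cong (3 ℕ.+_) n≡)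

Odd : ℤ → Set
Odd a = ∃ λ t → a ≡ + 1 + + 2 * t

odd≢even : ∀ {a} b → Odd a → + 2 * b ≢ a
odd≢even b (t , refl) 2b≡1+2t = ℕₚ.even≢odd ∣ b - t ∣ 0 (begin
    2 ℕ.* ∣ b - t ∣                  ≡⟨ ℤₚ.abs-* (+ 2) (b - t) ⟨
    ∣ + 2 * (b - t) ∣                ≡⟨ cong ∣_∣ (distrib b t) ⟩
    ∣ + 2 * b - + 2 * t ∣            ≡⟨ cong (λ c → ∣ c - + 2 * t ∣) 2b≡1+2t ⟩
    ∣ + 1 + + 2 * t - + 2 * t ∣      ≡⟨ cong ∣_∣ (cancel t) ⟩
    1                                ∎)
  where
  open ≡-Reasoning
  distrib : ∀ b t → + 2 * (b - t) ≡ + 2 * b - + 2 * t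
  distrib = solve-∀
  cancel : ∀ t → + 1 + + 2 * t - + 2 * t ≡ + 1
  cancel = solve-∀

¬2∣⇒Odd : ∀ n → ¬ 2 ∣ n → Odd (+ n)
¬2∣⇒Odd 0             2∤0   = ⊥-elim (2∤0 (divides 0 refl))
¬2∣⇒Odd 1             _     = + 0 , refl
¬2∣⇒Odd (suc (suc n)) 2∤n+2 with ¬2∣⇒Odd n (2∤n+2 ∘ ∣m∣n⇒∣m+n ∣-refl)
... | t , n≡1+2t = t + + 1 , trans (cong (_+_ (+ 2)) n≡1+2t) (shift t)
  where
  shift : ∀ t → + 2 + (+ 1 + + 2 * t) ≡ + 1 + + 2 * (t + + 1)
  shift = solve-∀

pos-2^suc : ∀ n → + (2 ^ suc n) ≡ + 2 * + (2 ^ n)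
pos-2^suc n = ℤₚ.pos-* 2 (2 ^ n)

2^[1+j]x≡2^jy⇒2x≡y : ∀ j x y → + (2 ^ suc j) * x ≡ + (2 ^ j) * y → + 2 * x ≡ y
2^[1+j]x≡2^jy⇒2x≡y j x y eq =
  ℤₚ.*-cancelˡ-≡ (+ (2 ^ j)) (+ 2 * x) y {{ℕₚ.m^n≢0 2 j}}
    (trans (regroup (+ (2 ^ j)) x) (trans (cong (_* x) (sym (pos-2^suc j))) eq))
  where
  regroup : ∀ P x → P * (+ 2 * x) ≡ + 2 * P * x
  regroup = solve-∀

infixr 7 _·_

_·_ : ℤ → ℤ[α] → ℤ[α]
c · w = record { re = c * re w ; im = c * im w }

-- The ring solver does not unfold _⊛_, so identities in ℤ[α] are checked coordinatewise,
-- with both coordinates written out.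
ι-⊛ : ∀ c w → ι c ⊛ w ≡ c · w
ι-⊛ c (a + b α) = cong₂ _+_α (re-eq c a b) (im-eq c a b)
  where
  re-eq : ∀ c a b → c * a + + 0 * b ≡ c * a
  re-eq = solve-∀
  im-eq : ∀ c a b → c * b + + 0 * a + + 0 * b ≡ c * b
  im-eq = solve-∀

·-identityˡ : ∀ w → + 1 · w ≡ w
·-identityˡ (a + b α) = cong₂ _+_α (ℤₚ.*-identityˡ a) (ℤₚ.*-identityˡ b)

⊛-identityˡ : ∀ w → one ⊛ w ≡ w
⊛-identityˡ (a + b α) = cong₂ _+_α (re-eq a b) (im-eq a b)
  where
  re-eq : ∀ a b → + 1 * a + + 0 * b ≡ a
  re-eq = solve-∀
  im-eq : ∀ a b → + 1 * b + + 0 * a + + 0 * b ≡ b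
  im-eq = solve-∀

⊛-identityʳ : ∀ w → w ⊛ one ≡ w
⊛-identityʳ (a + b α) = cong₂ _+_α (re-eq a b) (im-eq a b)
  where
  re-eq : ∀ a b → a * + 1 + b * + 0 ≡ a
  re-eq = solve-∀
  im-eq : ∀ a b → a * + 0 + b * + 1 + b * + 0 ≡ b
  im-eq = solve-∀

⊛-assoc : ∀ x y z → x ⊛ (y ⊛ z) ≡ (x ⊛ y) ⊛ z
⊛-assoc (a + b α) (c + d α) (e + f α) =
  cong₂ _+_α (re-eq a b c d e f) (im-eq a b c d e f)
  where
  re-eq : ∀ a b c d e f →
    a * (c * e + d * f) + b * (c * f + d * e + d * f)
      ≡ (a * c + b * d) * e + (a * d + b * c + b * d) * f
  re-eq = solve-∀
  im-eq : ∀ a b c d e f →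
    a * (c * f + d * e + d * f) + b * (c * e + d * f) + b * (c * f + d * e + d * f)
      ≡ (a * c + b * d) * f + (a * d + b * c + b * d) * e + (a * d + b * c + b * d) * f
  im-eq = solve-∀

one⊕-⊖-one : ∀ w → (one ⊕ w) ⊖ one ≡ w
one⊕-⊖-one (a + b α) = cong₂ _+_α (re-eq a) (im-eq b)
  where
  re-eq : ∀ a → + 1 + a - + 1 ≡ a
  re-eq = solve-∀
  im-eq : ∀ b → + 0 + b - + 0 ≡ b
  im-eq = solve-∀

one⊕·-⊛ : ∀ c u v → (one ⊕ c · u) ⊛ (one ⊕ c · v) ≡ one ⊕ c · (u ⊕ v ⊕ c · (u ⊛ v))
one⊕·-⊛ c (a + b α) (d + e α) = cong₂ _+_α (re-eq c a b d e) (im-eq c a b d e)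
  where
  re-eq : ∀ c a b d e →
    (+ 1 + c * a) * (+ 1 + c * d) + (+ 0 + c * b) * (+ 0 + c * e)
      ≡ + 1 + c * (a + d + c * (a * d + b * e))
  re-eq = solve-∀
  im-eq : ∀ c a b d e →
    (+ 1 + c * a) * (+ 0 + c * e) + (+ 0 + c * b) * (+ 1 + c * d)
      + (+ 0 + c * b) * (+ 0 + c * e)
      ≡ + 0 + c * (b + e + c * (a * e + b * d + b * e))
  im-eq = solve-∀

one⊕·-square : ∀ c v → (one ⊕ (+ 2 * c) · v) ⊛ (one ⊕ (+ 2 * c) · v)
                         ≡ one ⊕ (+ 2 * (+ 2 * c)) · (v ⊕ c · (v ⊛ v))
one⊕·-square c v = trans (one⊕·-⊛ (+ 2 * c) v v) (cong (one ⊕_) (rescale (v ⊛ v)))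
  where
  halve : ∀ c a r → (+ 2 * c) * (a + a + (+ 2 * c) * r) ≡ (+ 2 * (+ 2 * c)) * (a + c * r)
  halve = solve-∀
  rescale : ∀ w → (+ 2 * c) · (v ⊕ v ⊕ (+ 2 * c) · w) ≡ (+ 2 * (+ 2 * c)) · (v ⊕ c · w)
  rescale w = cong₂ _+_α (halve c (re v) (re w)) (halve c (im v) (im w))

^α-+ : ∀ z m n → z ^α (m ℕ.+ n) ≡ z ^α m ⊛ z ^α n
^α-+ z zero    n = sym (⊛-identityˡ (z ^α n))
^α-+ z (suc m) n = trans (cong (z ⊛_) (^α-+ z m n)) (⊛-assoc z (z ^α m) (z ^α n))

^α-* : ∀ z m n → z ^α (m ℕ.* n) ≡ (z ^α n) ^α m
^α-* z zero    n = refl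
^α-* z (suc m) n = trans (^α-+ z n (m ℕ.* n)) (cong (z ^α n ⊛_) (^α-* z m n))

^α-2^suc : ∀ z n → z ^α (2 ^ suc n) ≡ z ^α (2 ^ n) ⊛ z ^α (2 ^ n)
^α-2^suc z n =
  trans (^α-* z 2 (2 ^ n)) (cong (z ^α (2 ^ n) ⊛_) (⊛-identityʳ (z ^α (2 ^ n))))

one⊕·-^ : ∀ c u m →
  ∃₂ λ v t → (one ⊕ c · u) ^α m ≡ one ⊕ c · v × re v ≡ + m * re u + c * t
one⊕·-^ c u zero = ι (+ 0) , + 0 , cong₂ _+_α (unit c) (unit′ c) , zero-eq (re u) c
  where
  unit : ∀ c → + 1 ≡ + 1 + c * + 0
  unit = solve-∀
  unit′ : ∀ c → + 0 ≡ + 0 + c * + 0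
  unit′ = solve-∀
  zero-eq : ∀ a c → + 0 ≡ + 0 * a + c * + 0
  zero-eq = solve-∀
one⊕·-^ c u (suc m) with one⊕·-^ c u m
... | v , t , zᵐ≡ , re-v≡ =
  u ⊕ v ⊕ c · (u ⊛ v) , t + re (u ⊛ v) ,
  trans (cong ((one ⊕ c · u) ⊛_) zᵐ≡) (one⊕·-⊛ c u v) ,
  trans (cong (λ r → re u + r + c * re (u ⊛ v)) re-v≡)
        (collect (+ m) (re u) c t (re (u ⊛ v)))
  where
  collect : ∀ M a c t r → a + (M * a + c * t) + c * r ≡ (+ 1 + M) * a + c * (t + r)
  collect = solve-∀

V₂α-2^·odd : ∀ j v → Odd (re v) ⊎ Odd (im v) → V₂α (+ (2 ^ j) · v) j
V₂α-2^·odd j v odd =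
  (v , ι-⊛ (+ (2 ^ j)) v) ,
  λ (w , eq) → not-double w odd (trans (sym (ι-⊛ (+ (2 ^ suc j)) w)) eq)
  where
  not-double : ∀ w → Odd (re v) ⊎ Odd (im v) → + (2 ^ suc j) · w ≢ + (2 ^ j) · v
  not-double w (inj₁ odd-re) eq =
    odd≢even (re w) odd-re (2^[1+j]x≡2^jy⇒2x≡y j (re w) (re v) (cong re eq))
  not-double w (inj₂ odd-im) eq =
    odd≢even (im w) odd-im (2^[1+j]x≡2^jy⇒2x≡y j (im w) (im v) (cong im eq))

Odd-im⇒V₂α-0 : ∀ {z} → Odd (im z) → V₂α z 0
Odd-im⇒V₂α-0 {z} odd = subst (λ w → V₂α w 0) (·-identityˡ z) (V₂α-2^·odd 0 z (inj₂ odd))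

-- An odd real part, rather than just 2 ∤ v, is what squaring preserves.
ExactOneMod : ℕ → ℤ[α] → Set
ExactOneMod j z = ∃ λ v → z ≡ one ⊕ + (2 ^ j) · v × Odd (re v)

ExactOneMod⇒V₂α[z⊖one] : ∀ j {z} → ExactOneMod j z → V₂α (z ⊖ one) j
ExactOneMod⇒V₂α[z⊖one] j (v , refl , odd) =
  subst (λ w → V₂α w j) (sym (one⊕-⊖-one _)) (V₂α-2^·odd j v (inj₁ odd))

ExactOneMod-square : ∀ i {z} →
  ExactOneMod (suc (suc i)) z → ExactOneMod (suc (suc (suc i))) (z ⊛ z)
ExactOneMod-square i (v , refl , t , re-v≡) =
  v ⊕ c · (v ⊛ v) , square≡ , t + + (2 ^ i) * re (v ⊛ v) , re≡
  where
  c : ℤ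
  c = + (2 ^ suc i)
  2c≡ : + (2 ^ suc (suc i)) ≡ + 2 * c
  2c≡ = pos-2^suc (suc i)
  4c≡ : + (2 ^ suc (suc (suc i))) ≡ + 2 * (+ 2 * c)
  4c≡ = trans (pos-2^suc (suc (suc i))) (cong (_*_ (+ 2)) 2c≡)
  square≡ : (one ⊕ + (2 ^ suc (suc i)) · v) ⊛ (one ⊕ + (2 ^ suc (suc i)) · v)
              ≡ one ⊕ + (2 ^ suc (suc (suc i))) · (v ⊕ c · (v ⊛ v))
  square≡ = subst₂ (λ d e → (one ⊕ d · v) ⊛ (one ⊕ d · v) ≡ one ⊕ e · (v ⊕ c · (v ⊛ v)))
              (sym 2c≡) (sym 4c≡) (one⊕·-square c v)
  collect : ∀ t P r → + 1 + + 2 * t + + 2 * P * r ≡ + 1 + + 2 * (t + P * r)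
  collect = solve-∀
  re≡ : re v + c * re (v ⊛ v) ≡ + 1 + + 2 * (t + + (2 ^ i) * re (v ⊛ v))
  re≡ = trans (cong₂ (λ a d → a + d * re (v ⊛ v)) re-v≡ (pos-2^suc i))
              (collect t (+ (2 ^ i)) (re (v ⊛ v)))

ExactOneMod-^2^ : ∀ n {j z} →
  ExactOneMod (suc (suc j)) z → ExactOneMod (suc (suc (n ℕ.+ j))) (z ^α (2 ^ n))
ExactOneMod-^2^ zero    {j} {z} e = subst (ExactOneMod (suc (suc j))) (sym (⊛-identityʳ z)) e
ExactOneMod-^2^ (suc n) {j} {z} e =
  subst (ExactOneMod (suc (suc (suc n ℕ.+ j)))) (sym (^α-2^suc z n))
    (ExactOneMod-square (n ℕ.+ j) (ExactOneMod-^2^ n e))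

ExactOneMod-^odd : ∀ {z} m → ¬ 2 ∣ m → ExactOneMod 2 z → ExactOneMod 2 (z ^α m)
ExactOneMod-^odd m 2∤m (u , refl , s , re-u≡)
  with one⊕·-^ (+ 4) u m | ¬2∣⇒Odd m 2∤m
... | v , t , zᵐ≡ , re-v≡ | r , m≡1+2r =
  v , zᵐ≡ , r + s + + 2 * r * s + + 2 * t ,
  trans re-v≡ (trans (cong₂ (λ M a → M * a + + 4 * t) m≡1+2r re-u≡) (odd*odd r s t))
  where
  odd*odd : ∀ r s t → (+ 1 + + 2 * r) * (+ 1 + + 2 * s) + + 4 * t
                        ≡ + 1 + + 2 * (r + s + + 2 * r * s + + 2 * t)
  odd*odd = solve-∀

-- α⁶ = 5 + 8α = 1 + 4(1 + 2α)
ExactOneMod-α^6 : ExactOneMod 2 (α ^α 6)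
ExactOneMod-α^6 = one ⊕ + 2 · α , refl , + 0 , refl

Odd-im[w⊛[1+2v]⊖one] : ∀ w v → Odd (im w) → Odd (im ((w ⊛ (one ⊕ + 2 · v)) ⊖ one))
Odd-im[w⊛[1+2v]⊖one] (p + _ α) (a + b α) (t , refl) =
  p * b + a + t + + 2 * t * a + b + + 2 * t * b , expand p a b t
  where
  expand : ∀ p a b t →
    p * (+ 0 + + 2 * b) + (+ 1 + + 2 * t) * (+ 1 + + 2 * a)
      + (+ 1 + + 2 * t) * (+ 0 + + 2 * b) - + 0
      ≡ + 1 + + 2 * (p * b + a + t + + 2 * t * a + b + + 2 * t * b)
  expand = solve-∀

Odd-im[α^[r+q*3]⊖one] : ∀ r q →
  Odd (im (α ^α r)) → Odd (im ((α ^α (r ℕ.+ q ℕ.* 3)) ⊖ one))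
Odd-im[α^[r+q*3]⊖one] r q odd with one⊕·-^ (+ 2) α q
... | v , _ , α³ᵠ≡ , _ =
  subst (λ z → Odd (im (z ⊖ one))) (sym α^[r+q*3]≡) (Odd-im[w⊛[1+2v]⊖one] (α ^α r) v odd)
  where
  α^[r+q*3]≡ : α ^α (r ℕ.+ q ℕ.* 3) ≡ α ^α r ⊛ (one ⊕ + 2 · v)
  α^[r+q*3]≡ = trans (^α-+ α r (q ℕ.* 3)) (cong (α ^α r ⊛_) (trans (^α-* α q 3) α³ᵠ≡))

ExactOneMod-α^[c*3*2^[i+1]] : ∀ i c →
  ¬ 2 ∣ c → ExactOneMod (suc (suc i)) (α ^α (c ℕ.* 3 ℕ.* 2 ^ suc i))
ExactOneMod-α^[c*3*2^[i+1]] i c 2∤c =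
  subst₂ ExactOneMod (cong (suc ∘ suc) (ℕₚ.+-identityʳ i)) (sym α^x≡)
    (ExactOneMod-^2^ i (ExactOneMod-^odd c 2∤c ExactOneMod-α^6))
  where
  regroup : ∀ c P → c ℕ.* 3 ℕ.* (2 ℕ.* P) ≡ P ℕ.* (c ℕ.* 6)
  regroup = ℕ-Solver.solve-∀
  α^x≡ : α ^α (c ℕ.* 3 ℕ.* 2 ^ suc i) ≡ ((α ^α 6) ^α c) ^α (2 ^ i)
  α^x≡ = trans (cong (α ^α_) (regroup c (2 ^ i)))
           (trans (^α-* α (2 ^ i) (c ℕ.* 6)) (cong (_^α (2 ^ i)) (^α-* α c 6)))

valuation-multiple-of-3 : ∀ x k → 2 ∣ x → 3 ∣ x → V₂ x k → V₂α ((α ^α x) ⊖ one) (suc k)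
valuation-multiple-of-3 _ zero    2∣x _     (_ , 2∤x) = ⊥-elim (2∤x 2∣x)
valuation-multiple-of-3 x (suc i) _   3∣x v₂x≡ with V₂⇒odd-cofactor (suc i) v₂x≡
... | o , 2∤o , x≡o*2^k
  with prime∣m*n^k⇒∣m (suc i) (from-yes (prime? 3)) (from-no (3 ∣? 2)) (subst (3 ∣_) x≡o*2^k 3∣x)
... | divides c o≡c*3 =
  ExactOneMod⇒V₂α[z⊖one] (suc (suc i))
    (subst (λ y → ExactOneMod (suc (suc i)) (α ^α y)) (sym x≡c*3*2^k)
      (ExactOneMod-α^[c*3*2^[i+1]] i c 2∤c))
  where
  x≡c*3*2^k : x ≡ c ℕ.* 3 ℕ.* 2 ^ suc i
  x≡c*3*2^k = trans x≡o*2^k (cong (ℕ._* 2 ^ suc i) o≡c*3)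
  2∤c : ¬ 2 ∣ c
  2∤c 2∣c = 2∤o (subst (2 ∣_) (sym o≡c*3) (∣m⇒∣m*n 3 2∣c))

valuation-not-multiple-of-3 : ∀ x → ¬ 3 ∣ x → V₂α ((α ^α x) ⊖ one) 0
valuation-not-multiple-of-3 x 3∤x with ¬3∣⇒1+q*3⊎2+q*3 x 3∤x
... | q , inj₁ refl = Odd-im⇒V₂α-0 (Odd-im[α^[r+q*3]⊖one] 1 q (+ 0 , refl))
... | q , inj₂ refl = Odd-im⇒V₂α-0 (Odd-im[α^[r+q*3]⊖one] 2 q (+ 0 , refl))

corollary2 : (x : ℕ) → 2 ∣ x → 0 < x →
    ((3 ∣ x) → (k : ℕ) → V₂ x k → V₂α ((α ^α x) ⊖ one) (suc k))
    × (¬ (3 ∣ x) → V₂α ((α ^α x) ⊖ one) 0)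
corollary2 x 2∣x _ =
  (λ 3∣x k → valuation-multiple-of-3 x k 2∣x 3∣x) , valuation-not-multiple-of-3 x
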